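{- Let $G$ be a bi-block graph with $N$ vertices and $r$ blocks $K_{m_k,n_k}$ ($k=1,\dots,r$), let $q$ satisfy $q\neq -1$ and $q^2(m_k-1)(n_k-1)\neq 1$ for all $k$, and let $\mathbf{x}$ and $\lambda_G$ be as defined below. Then $$\sum_{i=1}^{N}\mathbf{x}_i=1-(q-1)\lambda_G.$$
   Context: $q$ is a real or complex number (the paper calls it an indeterminate). A bi-block graph is a connected graph each of whose blocks (maximal connected subgraphs without a cut-vertex) is complete bipartite; its blocks are $K_{m_k,n_k}$ with a fixed bipartition $X_k\cup Y_k$, $|X_k|=m_k$, $|Y_k|=n_k$; its vertices are $v_1,\dots,v_N$. For a vertex $v$ let $\hat d(v)$ be the number of blocks containing $v$; put $\Delta_k=q^2(m_k-1)(n_k-1)-1$. Define $$\mathbf{x}(v)=\sum_{k:\,v\in X_k}\frac{q(n_k-1)-1}{(q+1)\Delta_k}+\sum_{k:\,v\in Y_k}\frac{q(m_k-1)-1}{(q+1)\Delta_k}-(\hat d(v)-1),$$ $\mathbf{x}_i=\mathbf{x}(v_i)$, and $$\lambda_G=\sum_{k=1}^r\frac{(q+1)^2(m_k-1)(n_k-1)-m_kn_k}{(q+1)\left(q^2(m_k-1)(n_k-1)-1\right)}.$$ -}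

module Defs where

open import Level using (Level; _⊔_) renaming (suc to lsuc)
open import Data.Nat using (ℕ; zero; suc; _≤_)
open import Data.Fin using (Fin)
open import Data.Fin.Subset using (Subset; _∈_; _∉_; _⊆_; _∪_; ∣_∣; Nonempty)
open import Data.Fin.Subset.Properties using (_∈?_)
open import Data.Fin.Subset renaming (_-_ to _∖_) using ()
open import Data.Product using (_×_; Σ; ∃; ∃-syntax)
open import Data.Sum using (_⊎_)
open import Data.Empty using (⊥)
open import Relation.Nullary using (¬_; yes; no)
open import Relation.Binary.PropositionalEquality using (_≡_)
open import Algebra.Bundles using (CommutativeRing)
open import Function using (_⇔_)

-- Fields (the stdlib has no Field bundle).  A field is a commutative
-- ring with 0 ≠ 1 in which every nonzero element has an inverse.
-- The inverse of 0 is an arbitrary (unconstrained) value.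

record Field (c ℓ : Level) : Set (lsuc (c ⊔ ℓ)) where
  field
    commutativeRing : CommutativeRing c ℓ
  open CommutativeRing commutativeRing public
  infix 8 _⁻¹
  field
    _⁻¹       : Carrier → Carrier
    ⁻¹-inverse : ∀ x → ¬ (x ≈ 0#) → x * (x ⁻¹) ≈ 1#
    0≉1       : ¬ (0# ≈ 1#)

  infixl 7 _÷_
  _÷_ : Carrier → Carrier → Carrier
  a ÷ b = a * (b ⁻¹)

  fromℕ : ℕ → Carrier
  fromℕ zero    = 0#
  fromℕ (suc n) = 1# + fromℕ n

  ∑ : (n : ℕ) → (Fin n → Carrier) → Carrier
  ∑ zero    f = 0#
  ∑ (suc n) f = f Fin.zero + ∑ n (λ i → f (Fin.suc i))

  CharacteristicZero : Set ℓ
  CharacteristicZero = ∀ n → ¬ (fromℕ (suc n) ≈ 0#)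

record Graph (N : ℕ) : Set₁ where
  field
    Adj      : Fin N → Fin N → Set
    Adj-sym  : ∀ {u v} → Adj u v → Adj v u
    Adj-irr  : ∀ {u} → ¬ Adj u u

module _ {N : ℕ} (G : Graph N) where
  open Graph G

  data WalkIn (S : Subset N) : Fin N → Fin N → Set where
    stay : ∀ {u} → u ∈ S → WalkIn S u u
    step : ∀ {u v w} → u ∈ S → Adj u v → WalkIn S v w → WalkIn S u w

  ConnectedIn : Subset N → Set
  ConnectedIn S = ∀ u w → u ∈ S → w ∈ S → WalkIn S u w

  CutVertexOf : Subset N → Fin N → Set
  CutVertexOf S v = v ∈ S × ¬ ConnectedIn (S ∖ v)

  Biconn : Subset N → Set
  Biconn S = Nonempty S × ConnectedIn S × (∀ v → ¬ CutVertexOf S v)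

  -- B is (the vertex set of) a block of G: a maximal connected
  -- subgraph without a cut vertex.  (Maximal such subgraphs are induced,
  -- so blocks are determined by their vertex sets.)
  IsBlock : Subset N → Set
  IsBlock B = Biconn B × (∀ C → B ⊆ C → Biconn C → C ⊆ B)

  Connected : Set
  Connected = Fin N × (∀ u w → WalkIn (Data.Fin.Subset.⊤ {N}) u w)

  record BiBlock (r : ℕ) (X Y : Fin r → Subset N) : Set where
    field
      connected    : Connected
      X-nonempty   : ∀ k → Nonempty (X k)
      Y-nonempty   : ∀ k → Nonempty (Y k)
      XY-disjoint  : ∀ k v → v ∈ X k → v ∉ Y k
      complete-bipartite : ∀ k u w → u ∈ (X k ∪ Y k) → w ∈ (X k ∪ Y k) →
        Adj u w ⇔ ((u ∈ X k × w ∈ Y k) ⊎ (u ∈ Y k × w ∈ X k))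
      isBlock      : ∀ k → IsBlock (X k ∪ Y k)
      distinct     : ∀ k l → X k ∪ Y k ≡ X l ∪ Y l → k ≡ l
      allBlocks    : ∀ B → IsBlock B → ∃[ k ] B ≡ X k ∪ Y k

module Quantities {c ℓ} (F : Field c ℓ) {N r : ℕ} (X Y : Fin r → Subset N) where
  open Field F

  m n : Fin r → Carrier
  m k = fromℕ ∣ X k ∣
  n k = fromℕ ∣ Y k ∣

  Δ : Carrier → Fin r → Carrier
  Δ q k = q * q * (m k - 1#) * (n k - 1#) - 1#

  ifIn : Fin N → Subset N → Carrier → Carrier
  ifIn v S a with v ∈? S
  ... | yes _ = a
  ... | no  _ = 0#

  dhat : Fin N → Carrier
  dhat v = ∑ r (λ k → ifIn v (X k ∪ Y k) 1#)

  x : Carrier → Fin N → Carrier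
  x q v = ∑ r (λ k → ifIn v (X k) ((q * (n k - 1#) - 1#) ÷ ((q + 1#) * Δ q k)))
        + ∑ r (λ k → ifIn v (Y k) ((q * (m k - 1#) - 1#) ÷ ((q + 1#) * Δ q k)))
        - (dhat v - 1#)

  λG : Carrier → Carrier
  λG q = ∑ r (λ k →
    ((q + 1#) * (q + 1#) * (m k - 1#) * (n k - 1#) - m k * n k)
      ÷ ((q + 1#) * (q * q * (m k - 1#) * (n k - 1#) - 1#)))

-- Summing x over the vertices and exchanging the order of summation, block k contributes
-- m_k a_k + n_k b_k (its two weights a_k, b_k times the sizes of its sides), while the
-- terms -(d̂(v) - 1) add up to N - Σ_k |B_k|.  The blocks of a connected graph form a tree,
-- so Σ_k (|B_k| - 1) = N - 1, and Σ_v x_v = 1 + Σ_k (m_k a_k + n_k b_k - 1); a polynomial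
-- identity turns each summand into -(q - 1) times the k-th term of λ_G.
--
-- The tree count is proved by growing a union U of blocks one adjacent block at a time,
-- keeping every other block meeting U in at most one vertex: a second meeting point would
-- close a cycle of blocks, impossible since by the ear lemma a simple path between two
-- vertices of a block stays inside it.  The classical steps (existence of blocks, deleting
-- a vertex from a biconnected set) run in the double-negation monad, which suffices because
-- the count is a decidable equation in ℕ.

module Submission where

open import Defs
open import Algebra.Bundles using (CommutativeRing; RawRing)
import Algebra.Solver.Ring
open import Algebra.Solver.Ring.AlmostCommutativeRing using (fromCommutativeRing; _-Raw-AlmostCommutative⟶_)
open import Data.Empty using (⊥-elim)
open import Data.Fin using (Fin; zero; suc)
open import Data.Fin.Subset using (Subset; _∈_; _∉_; _∪_; ⊤; ∣_∣; inside; outside)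
open import Data.Fin.Subset.Properties using (_∈?_; drop-there)
open import Data.Maybe using (Maybe; just; nothing)
open import Data.Nat as ℕ using (ℕ; zero; suc; _∸_)
open import Data.Nat.Properties using () renaming (_≟_ to _≟ℕ_)
open import Data.Product using (_×_; _,_)
open import Data.Product.Properties using (≡-dec)
open import Data.Vec using ([]; _∷_; here; there)
open import Function using (_∘_)
open import Level using (0ℓ)
open import Relation.Nullary using (¬_; yes; no)
open import Relation.Binary.PropositionalEquality using (_≡_)
import Relation.Binary.PropositionalEquality as ≡

module Subsets where
  open import Data.Nat using (_+_)
  open import Data.Nat.Properties using (+-identityʳ; +-assoc; +-commutativeSemigroup)
  open import Algebra.Properties.CommutativeSemigroup +-commutativeSemigroup using (interchange; x∙yz≈y∙xz)
  open import Data.Fin.Subset using (_∩_; _─_; _⊆_; _⊂_; ⊥; ⁅_⁆)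
  open import Data.Fin.Subset.Properties
    using (⊆-antisym; ⊆-min; p⊆p∪q; q⊆p∪q; x∈⁅x⁆; x∈p∩q⁻; x∈⁅y⁆⇒x≡y)
  open import Relation.Binary.PropositionalEquality using (refl; sym; trans; cong; cong₂; subst; module ≡-Reasoning)

  ∑⟨_⟩ : ∀ {n} → Subset n → (Fin n → ℕ) → ℕ
  ∑⟨ [] ⟩          w = 0
  ∑⟨ inside  ∷ p ⟩ w = w zero + ∑⟨ p ⟩ (w ∘ suc)
  ∑⟨ outside ∷ p ⟩ w = ∑⟨ p ⟩ (w ∘ suc)

  ∑⟨⊥⟩ : ∀ n (w : Fin n → ℕ) → ∑⟨ ⊥ ⟩ w ≡ 0
  ∑⟨⊥⟩ zero    w = refl
  ∑⟨⊥⟩ (suc n) w = ∑⟨⊥⟩ n (w ∘ suc)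

  ∑⟨⁅i⁆⟩ : ∀ {n} (i : Fin n) (w : Fin n → ℕ) → ∑⟨ ⁅ i ⁆ ⟩ w ≡ w i
  ∑⟨⁅i⁆⟩ {suc n} zero    w = trans (cong (w zero +_) (∑⟨⊥⟩ n (w ∘ suc))) (+-identityʳ _)
  ∑⟨⁅i⁆⟩ {suc n} (suc i) w = ∑⟨⁅i⁆⟩ i (w ∘ suc)

  ∣p∣≡∑⟨p⟩1 : ∀ {n} (p : Subset n) → ∣ p ∣ ≡ ∑⟨ p ⟩ (λ _ → 1)
  ∣p∣≡∑⟨p⟩1 []            = refl
  ∣p∣≡∑⟨p⟩1 (inside  ∷ p) = cong suc (∣p∣≡∑⟨p⟩1 p)
  ∣p∣≡∑⟨p⟩1 (outside ∷ p) = ∣p∣≡∑⟨p⟩1 p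

  ∑⟨p∪q⟩+∑⟨p∩q⟩ : ∀ {n} (p q : Subset n) (w : Fin n → ℕ) →
                  ∑⟨ p ∪ q ⟩ w + ∑⟨ p ∩ q ⟩ w ≡ ∑⟨ p ⟩ w + ∑⟨ q ⟩ w
  ∑⟨p∪q⟩+∑⟨p∩q⟩ []      []      w = refl
  ∑⟨p∪q⟩+∑⟨p∩q⟩ (s ∷ p) (t ∷ q) w = go s t
    where
    open ≡-Reasoning
    w₀ = w zero
    u = ∑⟨ p ∪ q ⟩ (w ∘ suc)
    i = ∑⟨ p ∩ q ⟩ (w ∘ suc)
    a = ∑⟨ p ⟩ (w ∘ suc)
    b = ∑⟨ q ⟩ (w ∘ suc)
    ih : u + i ≡ a + b
    ih = ∑⟨p∪q⟩+∑⟨p∩q⟩ p q (w ∘ suc)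
    go : ∀ s t → ∑⟨ (s ∷ p) ∪ (t ∷ q) ⟩ w + ∑⟨ (s ∷ p) ∩ (t ∷ q) ⟩ w ≡ ∑⟨ s ∷ p ⟩ w + ∑⟨ t ∷ q ⟩ w
    go inside inside = begin
      (w₀ + u) + (w₀ + i) ≡⟨ interchange w₀ u w₀ i ⟩
      (w₀ + w₀) + (u + i) ≡⟨ cong ((w₀ + w₀) +_) ih ⟩
      (w₀ + w₀) + (a + b) ≡⟨ interchange w₀ w₀ a b ⟩
      (w₀ + a) + (w₀ + b) ∎
    go inside outside = trans (+-assoc w₀ u i) (trans (cong (w₀ +_) ih) (sym (+-assoc w₀ a b)))
    go outside inside = trans (+-assoc w₀ u i) (trans (cong (w₀ +_) ih) (x∙yz≈y∙xz w₀ a b))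
    go outside outside = ih

  ∣p∪q∣+∣p∩q∣ : ∀ {n} (p q : Subset n) → ∣ p ∪ q ∣ + ∣ p ∩ q ∣ ≡ ∣ p ∣ + ∣ q ∣
  ∣p∪q∣+∣p∩q∣ p q = begin
    ∣ p ∪ q ∣ + ∣ p ∩ q ∣                           ≡⟨ cong₂ _+_ (∣p∣≡∑⟨p⟩1 (p ∪ q)) (∣p∣≡∑⟨p⟩1 (p ∩ q)) ⟩
    ∑⟨ p ∪ q ⟩ (λ _ → 1) + ∑⟨ p ∩ q ⟩ (λ _ → 1)     ≡⟨ ∑⟨p∪q⟩+∑⟨p∩q⟩ p q _ ⟩
    ∑⟨ p ⟩ (λ _ → 1) + ∑⟨ q ⟩ (λ _ → 1)             ≡⟨ cong₂ _+_ (∣p∣≡∑⟨p⟩1 p) (∣p∣≡∑⟨p⟩1 q) ⟨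
    ∣ p ∣ + ∣ q ∣                                   ∎
    where open ≡-Reasoning

  p∩⁅i⁆≡⊥ : ∀ {n} {p : Subset n} {i} → i ∉ p → p ∩ ⁅ i ⁆ ≡ ⊥
  p∩⁅i⁆≡⊥ {p = p} {i} i∉p = ⊆-antisym p∩⁅i⁆⊆⊥ (⊆-min _)
    where
    p∩⁅i⁆⊆⊥ : p ∩ ⁅ i ⁆ ⊆ ⊥
    p∩⁅i⁆⊆⊥ x∈ with x∈p∩q⁻ p ⁅ i ⁆ x∈
    ... | x∈p , x∈⁅i⁆ = ⊥-elim (i∉p (subst (_∈ p) (x∈⁅y⁆⇒x≡y i x∈⁅i⁆) x∈p))

  ∑⟨p∪⁅i⁆⟩ : ∀ {n} {p : Subset n} {i} (w : Fin n → ℕ) → i ∉ p → ∑⟨ p ∪ ⁅ i ⁆ ⟩ w ≡ ∑⟨ p ⟩ w + w i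
  ∑⟨p∪⁅i⁆⟩ {n} {p} {i} w i∉p = begin
    ∑⟨ p ∪ ⁅ i ⁆ ⟩ w                          ≡⟨ +-identityʳ _ ⟨
    ∑⟨ p ∪ ⁅ i ⁆ ⟩ w + 0                      ≡⟨ cong (∑⟨ p ∪ ⁅ i ⁆ ⟩ w +_) (∑⟨⊥⟩ n w) ⟨
    ∑⟨ p ∪ ⁅ i ⁆ ⟩ w + ∑⟨ ⊥ ⟩ w               ≡⟨ cong (λ q → ∑⟨ p ∪ ⁅ i ⁆ ⟩ w + ∑⟨ q ⟩ w) (p∩⁅i⁆≡⊥ i∉p) ⟨
    ∑⟨ p ∪ ⁅ i ⁆ ⟩ w + ∑⟨ p ∩ ⁅ i ⁆ ⟩ w       ≡⟨ ∑⟨p∪q⟩+∑⟨p∩q⟩ p ⁅ i ⁆ w ⟩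
    ∑⟨ p ⟩ w + ∑⟨ ⁅ i ⁆ ⟩ w                   ≡⟨ cong (∑⟨ p ⟩ w +_) (∑⟨⁅i⁆⟩ i w) ⟩
    ∑⟨ p ⟩ w + w i                            ∎
    where open ≡-Reasoning

  ∣p∪⁅i⁆∣ : ∀ {n} {p : Subset n} {i} → i ∉ p → ∣ p ∪ ⁅ i ⁆ ∣ ≡ ∣ p ∣ + 1
  ∣p∪⁅i⁆∣ {p = p} {i} i∉p =
    trans (∣p∣≡∑⟨p⟩1 (p ∪ ⁅ i ⁆)) (trans (∑⟨p∪⁅i⁆⟩ _ i∉p) (cong (_+ 1) (sym (∣p∣≡∑⟨p⟩1 p))))

  x∈p─q⇒x∉q : ∀ {n} {x : Fin n} {p q : Subset n} → x ∈ p ─ q → x ∉ q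
  x∈p─q⇒x∉q {p = _ ∷ p}      {inside  ∷ q} (there x∈) (there x∈q) = x∈p─q⇒x∉q {p = p} x∈ x∈q
  x∈p─q⇒x∉q {p = _ ∷ p}      {outside ∷ q} (there x∈) (there x∈q) = x∈p─q⇒x∉q {p = p} x∈ x∈q
  x∈p─q⇒x∉q {p = inside ∷ p} {outside ∷ q} here ()

  p⊂p∪⁅i⁆ : ∀ {n} {p : Subset n} {i} → i ∉ p → p ⊂ p ∪ ⁅ i ⁆
  p⊂p∪⁅i⁆ {p = p} {i} i∉p = p⊆p∪q ⁅ i ⁆ , i , q⊆p∪q p ⁅ i ⁆ (x∈⁅x⁆ i) , i∉p

open Subsets using (∑⟨_⟩)

module Graphs where
  open Subsets
  open import Data.Nat using (_+_)
  open import Data.Nat.Properties using (suc-injective)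
  open import Data.Nat.Tactic.RingSolver using (solve-∀)
  open import Data.Fin using (_≟_)
  open import Data.Fin.Properties using (any?)
  open import Data.Fin.Subset using (_∩_; _-_; _⊆_; _⊂_; _⊃_; ⊥; ⁅_⁆; Nonempty)
  open import Data.Fin.Subset.Induction using (⊃-wellFounded)
  open import Data.Fin.Subset.Properties
    using (x∈p∪q⁺; x∈p∪q⁻; p⊆p∪q; q⊆p∪q; x∈p∧x≢y⇒x∈p-y; p─q⊆p; x∈⁅x⁆; x∈⁅y⁆⇒x≡y; ∉⊥; ⊆-antisym;
           x∈p∩q⁺; x∈p∩q⁻; ∣⁅x⁆∣≡1; ∣⊤∣≡n; ∈⊤; ⊆⊤)
  open import Data.List using (List; []; _∷_)
  open import Data.List.Membership.Propositional using () renaming (_∈_ to _∈ₗ_; _∉_ to _∉ₗ_)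
  open import Data.List.Relation.Unary.Any using (here; there)
  open import Data.List.Relation.Unary.All using ([])
  open import Data.List.Relation.Unary.All.Properties using (¬Any⇒All¬; All¬⇒¬Any)
  open import Data.List.Relation.Unary.AllPairs using ([]; _∷_)
  open import Data.List.Relation.Unary.Unique.Propositional using (Unique)
  open import Data.Product using (∃-syntax; Σ-syntax; proj₁; proj₂)
  open import Data.Sum using (_⊎_; inj₁; inj₂)
  open import Effect.Monad using (RawMonad)
  open import Function using (case_of_)
  open import Induction.WellFounded using (Acc; acc)
  open import Relation.Nullary using (¬?)
  open import Relation.Nullary.Decidable using (decidable-stable; ¬¬-excluded-middle)
  open import Relation.Nullary.Negation using (¬¬-Monad)
  open import Relation.Unary using (Decidable)
  open import Relation.Binary.PropositionalEquality
    using (_≢_; refl; sym; trans; cong; cong₂; subst; subst₂; module ≡-Reasoning)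

  module Walks {N : ℕ} (G : Graph N) where
    open Graph G
    open import Data.List.Membership.DecPropositional (_≟_ {N}) using () renaming (_∈?_ to _∈ₗ?_)

    data Walk (P : Fin N → Set) : Fin N → Fin N → Set where
      nil  : ∀ {u} → P u → Walk P u u
      cons : ∀ {u v w} → P u → Adj u v → Walk P v w → Walk P u w

    private
      variable
        P Q : Fin N → Set
        u v w x : Fin N

    first : Walk P u w → P u
    first (nil pu)      = pu
    first (cons pu _ _) = pu

    last : Walk P u w → P w
    last (nil pw)     = pw
    last (cons _ _ p) = last p

    map : (∀ {z} → P z → Q z) → Walk P u w → Walk Q u w
    map f (nil pu)      = nil (f pu)
    map f (cons pu e p) = cons (f pu) e (map f p)

    _++_ : Walk P u v → Walk P v w → Walk P u w
    nil _       ++ q = q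
    cons pu e p ++ q = cons pu e (p ++ q)

    reverse : Walk P u w → Walk P w u
    reverse (nil pu)      = nil pu
    reverse (cons pu e p) = reverse p ++ cons (first p) (Adj-sym e) (nil pu)

    vertices : Walk P u w → List (Fin N)
    vertices (nil {u} _)      = u ∷ []
    vertices (cons {u} _ _ p) = u ∷ vertices p

    vertices-map : (f : ∀ {z} → P z → Q z) (p : Walk P u w) → vertices (map f p) ≡ vertices p
    vertices-map f (nil _)      = refl
    vertices-map f (cons _ _ p) = cong (_ ∷_) (vertices-map f p)

    start∈ : (p : Walk P u w) → u ∈ₗ vertices p
    start∈ (nil _)      = here refl
    start∈ (cons _ _ _) = here refl

    vertex-satisfies : (p : Walk P u w) → x ∈ₗ vertices p → P x
    vertex-satisfies (nil pu)      (here refl) = pu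
    vertex-satisfies (cons pu _ _) (here refl) = pu
    vertex-satisfies (cons _ _ p)  (there x∈) = vertex-satisfies p x∈

    suffix : (p : Walk P u w) → x ∈ₗ vertices p → Walk (_∈ₗ vertices p) x w
    suffix (nil _)       (here refl) = nil (here refl)
    suffix (cons _ e p)  (here refl) = cons (here refl) e (map there (suffix p (start∈ p)))
    suffix (cons _ _ p)  (there x∈) = map there (suffix p x∈)

    simple-suffix : (p : Walk P x w) → Unique (vertices p) → u ∈ₗ vertices p →
                    Σ[ s ∈ Walk P u w ] Unique (vertices s)
    simple-suffix (nil pu)      p-simple       (here refl) = nil pu , p-simple
    simple-suffix (cons pu e p) p-simple       (here refl) = cons pu e p , p-simple
    simple-suffix (cons _ _ p)  (_ ∷ p-simple) (there u∈) = simple-suffix p p-simple u∈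

    simplify : Walk P u w → Σ[ s ∈ Walk P u w ] Unique (vertices s)
    simplify (nil pu) = nil pu , [] ∷ []
    simplify {u = u} (cons pu e p) with simplify p
    ... | s , s-simple with u ∈ₗ? vertices s
    ...   | yes u∈s = simple-suffix s s-simple u∈s
    ...   | no  u∉s = cons pu e s , ¬Any⇒All¬ (vertices s) u∉s ∷ s-simple

    Avoiding : (Fin N → Set) → Fin N → Fin N → Set
    Avoiding P v z = P z × z ≢ v

    there-avoiding : ∀ {y ys z} → Avoiding (_∈ₗ ys) v z → Avoiding (_∈ₗ y ∷ ys) v z
    there-avoiding (z∈ , z≢v) = there z∈ , z≢v

    suffix-avoiding : (p : Walk P u w) → v ∉ₗ vertices p → x ∈ₗ vertices p →
                      Walk (Avoiding (_∈ₗ vertices p) v) x w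
    suffix-avoiding p v∉p x∈p = map (λ z∈p → z∈p , λ { refl → v∉p z∈p }) (suffix p x∈p)

    path-avoiding : (p : Walk P u w) → Unique (vertices p) → x ∈ₗ vertices p → x ≢ v →
                    Walk (Avoiding (_∈ₗ vertices p) v) x u ⊎ Walk (Avoiding (_∈ₗ vertices p) v) x w
    path-avoiding (nil _)      _ (here refl) x≢v = inj₁ (nil (here refl , x≢v))
    path-avoiding (cons _ _ _) _ (here refl) x≢v = inj₁ (nil (here refl , x≢v))
    path-avoiding {v = v} (cons {u} pu e p) (u∉p ∷ p-simple) (there x∈p) x≢v
      with path-avoiding p p-simple x∈p x≢v | u ≟ v
    ... | inj₂ q | _        = inj₂ (map there-avoiding q)
    ... | inj₁ q | no u≢v   =
      inj₁ (map there-avoiding q ++ cons (there (start∈ p) , proj₂ (last q)) (Adj-sym e) (nil (here refl , u≢v)))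
    ... | inj₁ _ | yes refl = inj₂ (map there-avoiding (suffix-avoiding p (All¬⇒¬Any u∉p) x∈p))

    crossing : Decidable Q → Walk P u w → ¬ Q u → Q w →
               ∃[ c ] ∃[ d ] P c × P d × ¬ Q c × Q d × Adj c d
    crossing Q? (nil _) ¬Qu Qw = ⊥-elim (¬Qu Qw)
    crossing Q? (cons {v = v} pu e p) ¬Qu Qw with Q? v
    ... | yes Qv = _ , v , pu , first p , ¬Qu , Qv , e
    ... | no ¬Qv = crossing Q? p ¬Qv Qw

  module Biconnectivity {N : ℕ} (G : Graph N) where
    open Graph G
    open Walks G
    open RawMonad (¬¬-Monad {0ℓ})

    private
      variable
        P Q H : Fin N → Set
        S T C E : Subset N
        u w a b v : Fin N

    Linked : (Fin N → Set) → Set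
    Linked Q = ∀ {x y} → Q x → Q y → Walk Q x y

    linked-via-hub : (∀ {x} → Q x → ∃[ h ] H h × Walk Q x h) →
                     (∀ {h h′} → H h → H h′ → Walk Q h h′) → Linked Q
    linked-via-hub reach hubs-linked Qx Qy with reach Qx | reach Qy
    ... | _ , Hh , p | _ , Hh′ , q = p ++ (hubs-linked Hh Hh′ ++ reverse q)

    linked-clique : (∀ {x y} → Q x → Q y → x ≢ y → Adj x y) → Linked Q
    linked-clique adj {x} {y} Qx Qy with x ≟ y
    ... | yes refl = nil Qx
    ... | no x≢y   = cons Qx (adj Qx Qy x≢y) (nil Qy)

    fromWalkIn : WalkIn G S u w → Walk (_∈ S) u w
    fromWalkIn (stay u∈)     = nil u∈
    fromWalkIn (step u∈ e p) = cons u∈ e (fromWalkIn p)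

    toWalkIn : Walk (_∈ S) u w → WalkIn G S u w
    toWalkIn (nil u∈)      = stay u∈
    toWalkIn (cons u∈ e p) = step u∈ e (toWalkIn p)

    ∈-minus⁻ : ∀ {x} → x ∈ S - v → Avoiding (_∈ S) v x
    ∈-minus⁻ {S = S} {v} x∈ = p─q⊆p S ⁅ v ⁆ x∈ , λ { refl → x∈p─q⇒x∉q {p = S} x∈ (x∈⁅x⁆ v) }

    ∈-minus⁺ : ∀ {x} → Avoiding (_∈ S) v x → x ∈ S - v
    ∈-minus⁺ (x∈ , x≢v) = x∈p∧x≢y⇒x∈p-y x∈ x≢v

    biconn⇒linked : Biconn G S → Linked (_∈ S)
    biconn⇒linked (_ , connected , _) x∈ y∈ = fromWalkIn (connected _ _ x∈ y∈)

    biconn⇒linked-avoiding : Biconn G S → ∀ v → ¬ ¬ Linked (Avoiding (_∈ S) v)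
    biconn⇒linked-avoiding {S} (_ , connected , no-cut) v with v ∈? S
    ... | yes v∈S = λ ¬linked → no-cut v (v∈S , λ connected-v → ¬linked λ x y →
          map ∈-minus⁻ (fromWalkIn (connected-v _ _ (∈-minus⁺ x) (∈-minus⁺ y))))
    ... | no  v∉S = pure λ {_} {_} x y →
          map (λ z∈ → z∈ , λ { refl → v∉S z∈ }) (fromWalkIn (connected _ _ (proj₁ x) (proj₁ y)))

    biconn-intro : Nonempty S → Linked (_∈ S) → (∀ v → ¬ ¬ Linked (Avoiding (_∈ S) v)) → Biconn G S
    biconn-intro nonempty linked linked-avoiding =
      nonempty ,
      (λ _ _ x∈ y∈ → toWalkIn (linked x∈ y∈)) ,
      λ v (_ , disconnected) → linked-avoiding v λ l →
        disconnected λ _ _ x∈ y∈ → toWalkIn (map ∈-minus⁺ (l (∈-minus⁻ x∈) (∈-minus⁻ y∈)))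

    ear : Biconn G S →
          (∀ {x} → x ∈ E → ∃[ s ] s ∈ S × Walk (_∈ E) x s) →
          (∀ v → ¬ ¬ (∀ {x} → x ∈ E → x ≢ v → ∃[ s ] s ∈ S × Walk (Avoiding (_∈ E) v) x s)) →
          Biconn G (S ∪ E)
    ear {S} {E} S-biconn attached attached-avoiding =
      biconn-intro (u₀ , p⊆p∪q E u₀∈S) (linked-via-hub reach S-linked) linked-avoiding
      where
      u₀ = proj₁ (proj₁ S-biconn)
      u₀∈S = proj₂ (proj₁ S-biconn)

      reach : ∀ {x} → x ∈ S ∪ E → ∃[ s ] s ∈ S × Walk (_∈ S ∪ E) x s
      reach {x} x∈ with x∈p∪q⁻ S E x∈
      ... | inj₁ x∈S = x , x∈S , nil x∈
      ... | inj₂ x∈E with attached x∈E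
      ...   | s , s∈S , p = s , s∈S , map (q⊆p∪q S E) p

      S-linked : ∀ {s t} → s ∈ S → t ∈ S → Walk (_∈ S ∪ E) s t
      S-linked s∈ t∈ = map (p⊆p∪q E) (biconn⇒linked S-biconn s∈ t∈)

      reach-avoiding : ∀ {v} → (∀ {x} → x ∈ E → x ≢ v → ∃[ s ] s ∈ S × Walk (Avoiding (_∈ E) v) x s) →
                       ∀ {x} → Avoiding (_∈ S ∪ E) v x → ∃[ s ] Avoiding (_∈ S) v s × Walk (Avoiding (_∈ S ∪ E) v) x s
      reach-avoiding E-attached {x} (x∈ , x≢v) with x∈p∪q⁻ S E x∈
      ... | inj₁ x∈S = x , (x∈S , x≢v) , nil (x∈ , x≢v)
      ... | inj₂ x∈E with E-attached x∈E x≢v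
      ...   | s , s∈S , p = s , (s∈S , proj₂ (last p)) , map (λ (z∈ , z≢v) → q⊆p∪q S E z∈ , z≢v) p

      linked-avoiding : ∀ v → ¬ ¬ Linked (Avoiding (_∈ S ∪ E) v)
      linked-avoiding v = do
        S-linked-avoiding ← biconn⇒linked-avoiding S-biconn v
        E-attached ← attached-avoiding v
        pure (λ {_} {_} → linked-via-hub (reach-avoiding E-attached) λ s t →
          map (λ (z∈ , z≢v) → p⊆p∪q E z∈ , z≢v) (S-linked-avoiding s t))

  module Blocks {N : ℕ} (G : Graph N) where
    open Graph G
    open Walks G
    open Biconnectivity G
    open RawMonad (¬¬-Monad {0ℓ})

    private
      variable
        P : Fin N → Set
        S T C : Subset N
        u w a b x : Fin N

    ∪-biconn : Biconn G S → Biconn G T → a ≢ b → a ∈ S → b ∈ S → a ∈ T → b ∈ T → Biconn G (S ∪ T)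
    ∪-biconn {S} {T} {a} {b} S-biconn T-biconn a≢b a∈S b∈S a∈T b∈T =
      ear S-biconn (λ x∈T → a , a∈S , biconn⇒linked T-biconn x∈T a∈T) attached-avoiding
      where
      attached-avoiding : ∀ v → ¬ ¬ (∀ {x} → x ∈ T → x ≢ v → ∃[ s ] s ∈ S × Walk (Avoiding (_∈ T) v) x s)
      attached-avoiding v = do
        T-linked ← biconn⇒linked-avoiding T-biconn v
        pure λ {_} x∈T x≢v → case a ≟ v of λ where
          (no a≢v)   → a , a∈S , T-linked (x∈T , x≢v) (a∈T , a≢v)
          (yes refl) → b , b∈S , T-linked (x∈T , x≢v) (b∈T , a≢b ∘ sym)

    blocks-share-≤1 : IsBlock G S → IsBlock G T → S ≢ T → a ∈ S → b ∈ S → a ∈ T → b ∈ T → a ≡ b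
    blocks-share-≤1 {S} {T} {a} {b} (S-biconn , S-maximal) (T-biconn , T-maximal) S≢T a∈S b∈S a∈T b∈T
      with a ≟ b
    ... | yes a≡b = a≡b
    ... | no  a≢b = ⊥-elim (S≢T (⊆-antisym (S∪T⊆T ∘ p⊆p∪q T) (S∪T⊆S ∘ q⊆p∪q S T)))
      where
      S∪T-biconn = ∪-biconn S-biconn T-biconn a≢b a∈S b∈S a∈T b∈T
      S∪T⊆S = S-maximal (S ∪ T) (p⊆p∪q T) S∪T-biconn
      S∪T⊆T = T-maximal (S ∪ T) (q⊆p∪q S T) S∪T-biconn

    clique-biconn : Nonempty C → (∀ {x y} → x ∈ C → y ∈ C → x ≢ y → Adj x y) → Biconn G C
    clique-biconn nonempty adj =
      biconn-intro nonempty (linked-clique adj) (λ _ → pure λ {_} {_} → linked-clique (λ x y → adj (proj₁ x) (proj₁ y)))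

    ⊆-block : Acc _⊃_ C → Biconn G C → ¬ ¬ (∃[ B ] IsBlock G B × C ⊆ B)
    ⊆-block {C} (acc larger) C-biconn = do
      extensible? ← ¬¬-excluded-middle {A = ∃[ D ] C ⊂ D × Biconn G D}
      case extensible? of λ where
        (yes (D , C⊂D , D-biconn)) → do
          B , B-block , D⊆B ← ⊆-block (larger C⊂D) D-biconn
          pure (B , B-block , λ {_} x∈C → D⊆B (proj₁ C⊂D x∈C))
        (no unextensible) → pure (C , (C-biconn , maximal unextensible) , λ {_} x∈C → x∈C)
      where
      maximal : ¬ (∃[ D ] C ⊂ D × Biconn G D) → ∀ D → C ⊆ D → Biconn G D → D ⊆ C
      maximal unextensible D C⊆D D-biconn {x} x∈D = decidable-stable (x ∈? C) λ x∉C →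
        unextensible (D , ((λ {y} → C⊆D {y}) , x , x∈D , x∉C) , D-biconn)

    listSubset : List (Fin N) → Subset N
    listSubset []       = ⊥
    listSubset (x ∷ xs) = ⁅ x ⁆ ∪ listSubset xs

    ∈-listSubset⁺ : ∀ {xs} → x ∈ₗ xs → x ∈ listSubset xs
    ∈-listSubset⁺ {x} (here refl) = x∈p∪q⁺ (inj₁ (x∈⁅x⁆ x))
    ∈-listSubset⁺     (there x∈)  = x∈p∪q⁺ (inj₂ (∈-listSubset⁺ x∈))

    ∈-listSubset⁻ : ∀ xs → x ∈ listSubset xs → x ∈ₗ xs
    ∈-listSubset⁻ []       x∈ = ⊥-elim (∉⊥ x∈)
    ∈-listSubset⁻ (y ∷ xs) x∈ with x∈p∪q⁻ ⁅ y ⁆ (listSubset xs) x∈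
    ... | inj₁ x∈y  = here (x∈⁅y⁆⇒x≡y y x∈y)
    ... | inj₂ x∈xs = there (∈-listSubset⁻ xs x∈xs)

    path-biconn : Biconn G S → u ∈ S → w ∈ S → (p : Walk P u w) → Unique (vertices p) →
                  Biconn G (S ∪ listSubset (vertices p))
    path-biconn {S} {u = u} {w} S-biconn u∈S w∈S p p-simple =
      ear S-biconn
        (λ x∈ → w , w∈S , map ∈-listSubset⁺ (suffix p (∈-listSubset⁻ _ x∈)))
        (λ v → pure λ {_} → attached-avoiding)
      where
      on-path = λ {v} {z} ((z∈ , z≢v) : Avoiding (_∈ₗ vertices p) v z) → ∈-listSubset⁺ z∈ , z≢v
      attached-avoiding : ∀ {v x} → x ∈ listSubset (vertices p) → x ≢ v →
                          ∃[ s ] s ∈ S × Walk (Avoiding (_∈ listSubset (vertices p)) v) x s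
      attached-avoiding x∈ x≢v with path-avoiding p p-simple (∈-listSubset⁻ _ x∈) x≢v
      ... | inj₁ q = u , u∈S , map on-path q
      ... | inj₂ q = w , w∈S , map on-path q

    path⊆block : IsBlock G S → u ∈ S → w ∈ S → (p : Walk P u w) → Unique (vertices p) →
                 x ∈ₗ vertices p → x ∈ S
    path⊆block {S} (S-biconn , S-maximal) u∈S w∈S p p-simple x∈p =
      S-maximal _ (p⊆p∪q _) (path-biconn S-biconn u∈S w∈S p p-simple)
        (q⊆p∪q S _ (∈-listSubset⁺ x∈p))

    shortcut-in-block : IsBlock G S → u ∈ S → w ∈ S → Walk P u w → Walk (λ z → P z × z ∈ S) u w
    shortcut-in-block S-block u∈S w∈S p with simplify p
    ... | s , s-simple = map (λ z∈ → vertex-satisfies s z∈ , path⊆block S-block u∈S w∈S s s-simple z∈)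
                             (suffix s (start∈ s))

  module BlockCount {N r : ℕ} (G : Graph N) (G-connected : Connected G) (B : Fin r → Subset N)
                    (isBlock : ∀ k → IsBlock G (B k)) (distinct : ∀ k l → B k ≡ B l → k ≡ l)
                    (allBlocks : ∀ C → IsBlock G C → ∃[ k ] C ≡ B k) where
    open Graph G
    open Walks G
    open Biconnectivity G
    open Blocks G
    open RawMonad (¬¬-Monad {0ℓ})

    private
      variable
        K : Subset r
        U C : Subset N
        k l : Fin r
        a b c d : Fin N

    B-biconn : ∀ k → Biconn G (B k)
    B-biconn k = proj₁ (isBlock k)

    size : Fin r → ℕ
    size k = ∣ B k ∣

    meet≤1 : k ≢ l → a ∈ B k → b ∈ B k → a ∈ B l → b ∈ B l → a ≡ b
    meet≤1 {k} {l} k≢l = blocks-share-≤1 (isBlock k) (isBlock l) (k≢l ∘ distinct k l)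

    in-some-block : Biconn G C → ¬ ¬ (∃[ k ] C ⊆ B k)
    in-some-block C-biconn = do
      D , D-block , C⊆D ← ⊆-block (⊃-wellFounded _) C-biconn
      let k , D≡Bk = allBlocks D D-block
      pure (k , λ {_} x∈C → subst (_ ∈_) D≡Bk (C⊆D x∈C))

    vertex-in-block : ∀ v → ¬ ¬ (∃[ k ] v ∈ B k)
    vertex-in-block v = do
      k , ⁅v⁆⊆Bk ← in-some-block (clique-biconn (v , x∈⁅x⁆ v) λ x∈ y∈ x≢y →
                     ⊥-elim (x≢y (trans (x∈⁅y⁆⇒x≡y v x∈) (sym (x∈⁅y⁆⇒x≡y v y∈)))))
      pure (k , ⁅v⁆⊆Bk (x∈⁅x⁆ v))

    edge-in-block : Adj c d → ¬ ¬ (∃[ k ] c ∈ B k × d ∈ B k)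
    edge-in-block {c} {d} c~d = do
      k , edge⊆Bk ← in-some-block (clique-biconn (c , c∈edge) adjacent)
      pure (k , edge⊆Bk c∈edge , edge⊆Bk d∈edge)
      where
      edge = ⁅ c ⁆ ∪ ⁅ d ⁆
      c∈edge = x∈p∪q⁺ (inj₁ (x∈⁅x⁆ c))
      d∈edge = x∈p∪q⁺ (inj₂ (x∈⁅x⁆ d))
      endpoint : ∀ {x} → x ∈ edge → x ≡ c ⊎ x ≡ d
      endpoint x∈ with x∈p∪q⁻ ⁅ c ⁆ ⁅ d ⁆ x∈
      ... | inj₁ x∈c = inj₁ (x∈⁅y⁆⇒x≡y c x∈c)
      ... | inj₂ x∈d = inj₂ (x∈⁅y⁆⇒x≡y d x∈d)
      adjacent : ∀ {x y} → x ∈ edge → y ∈ edge → x ≢ y → Adj x y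
      adjacent x∈ y∈ x≢y with endpoint x∈ | endpoint y∈
      ... | inj₁ refl | inj₁ refl = ⊥-elim (x≢y refl)
      ... | inj₁ refl | inj₂ refl = c~d
      ... | inj₂ refl | inj₁ refl = Adj-sym c~d
      ... | inj₂ refl | inj₂ refl = ⊥-elim (x≢y refl)

    -- The blocks in K form a subtree of the block tree, with vertex set U.
    record Cluster (K : Subset r) (U : Subset N) : Set where
      field
        covers     : k ∈ K → a ∈ B k → a ∈ U
        count      : ∑⟨ K ⟩ size + 1 ≡ ∣ U ∣ + ∣ K ∣
        inhabitant : Nonempty U
        linked     : Linked (_∈ U)
        separated  : l ∉ K → a ∈ B l → a ∈ U → b ∈ B l → b ∈ U → a ≡ b

    cluster-block : ∀ k → Cluster ⁅ k ⁆ (B k)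
    cluster-block k = record
      { covers     = λ j∈ a∈ → subst (λ j → _ ∈ B j) (x∈⁅y⁆⇒x≡y k j∈) a∈
      ; count      = cong₂ _+_ (∑⟨⁅i⁆⟩ k size) (sym (∣⁅x⁆∣≡1 k))
      ; inhabitant = proj₁ (B-biconn k)
      ; linked     = biconn⇒linked (B-biconn k)
      ; separated  = λ l∉ a∈Bl a∈Bk b∈Bl b∈Bk → meet≤1 (λ { refl → l∉ (x∈⁅x⁆ k) }) a∈Bl b∈Bl a∈Bk b∈Bk
      }

    count-step : ∀ {A s u κ u′} → A + 1 ≡ u + κ → u′ + 1 ≡ u + s → (A + s) + 1 ≡ u′ + (κ + 1)
    count-step {A} {s} {u} {κ} {u′} A+1≡u+κ u′+1≡u+s = suc-injective (begin
      ℕ.suc ((A + s) + 1)  ≡⟨ shape₁ A s ⟩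
      (A + 1) + (s + 1)    ≡⟨ cong (_+ (s + 1)) A+1≡u+κ ⟩
      (u + κ) + (s + 1)    ≡⟨ shape₂ u κ s ⟩
      (u + s) + (κ + 1)    ≡⟨ cong (_+ (κ + 1)) u′+1≡u+s ⟨
      (u′ + 1) + (κ + 1)   ≡⟨ shape₃ u′ κ ⟩
      ℕ.suc (u′ + (κ + 1)) ∎)
      where
      open ≡-Reasoning
      shape₁ : ∀ A s → ℕ.suc ((A + s) + 1) ≡ (A + 1) + (s + 1)
      shape₁ = solve-∀
      shape₂ : ∀ u κ s → (u + κ) + (s + 1) ≡ (u + s) + (κ + 1)
      shape₂ = solve-∀
      shape₃ : ∀ u κ → (u + 1) + (κ + 1) ≡ ℕ.suc (u + (κ + 1))
      shape₃ = solve-∀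

    module Extension {K U} (cluster : Cluster K U) {k z} (k∉K : k ∉ K) (z∈Bk : z ∈ B k) (z∈U : z ∈ U) where
      open Cluster cluster

      U∩Bk≡⁅z⁆ : U ∩ B k ≡ ⁅ z ⁆
      U∩Bk≡⁅z⁆ = ⊆-antisym only-z (λ a∈ → subst (_∈ U ∩ B k) (sym (x∈⁅y⁆⇒x≡y z a∈)) (x∈p∩q⁺ (z∈U , z∈Bk)))
        where
        only-z : U ∩ B k ⊆ ⁅ z ⁆
        only-z a∈ with x∈p∩q⁻ U (B k) a∈
        ... | a∈U , a∈Bk = subst (_∈ ⁅ z ⁆) (sym (separated k∉K a∈Bk a∈U z∈Bk z∈U)) (x∈⁅x⁆ z)

      count′ : ∑⟨ K ∪ ⁅ k ⁆ ⟩ size + 1 ≡ ∣ U ∪ B k ∣ + ∣ K ∪ ⁅ k ⁆ ∣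
      count′ = begin
        ∑⟨ K ∪ ⁅ k ⁆ ⟩ size + 1       ≡⟨ cong (_+ 1) (∑⟨p∪⁅i⁆⟩ size k∉K) ⟩
        (∑⟨ K ⟩ size + size k) + 1    ≡⟨ count-step count ∣U∪Bk∣+1 ⟩
        ∣ U ∪ B k ∣ + (∣ K ∣ + 1)     ≡⟨ cong (∣ U ∪ B k ∣ +_) (∣p∪⁅i⁆∣ k∉K) ⟨
        ∣ U ∪ B k ∣ + ∣ K ∪ ⁅ k ⁆ ∣   ∎
        where
        open ≡-Reasoning
        ∣U∪Bk∣+1 : ∣ U ∪ B k ∣ + 1 ≡ ∣ U ∣ + size k
        ∣U∪Bk∣+1 = begin
          ∣ U ∪ B k ∣ + 1            ≡⟨ cong (∣ U ∪ B k ∣ +_) (∣⁅x⁆∣≡1 z) ⟨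
          ∣ U ∪ B k ∣ + ∣ ⁅ z ⁆ ∣     ≡⟨ cong (λ S → ∣ U ∪ B k ∣ + ∣ S ∣) U∩Bk≡⁅z⁆ ⟨
          ∣ U ∪ B k ∣ + ∣ U ∩ B k ∣   ≡⟨ ∣p∪q∣+∣p∩q∣ U (B k) ⟩
          ∣ U ∣ + size k             ∎

      linked′ : Linked (_∈ U ∪ B k)
      linked′ = linked-via-hub reach (λ { refl refl → nil (p⊆p∪q (B k) z∈U) })
        where
        reach : ∀ {x} → x ∈ U ∪ B k → ∃[ h ] h ≡ z × Walk (_∈ U ∪ B k) x h
        reach x∈ with x∈p∪q⁻ U (B k) x∈
        ... | inj₁ x∈U  = z , refl , map (p⊆p∪q (B k)) (linked x∈U z∈U)
        ... | inj₂ x∈Bk = z , refl , map (q⊆p∪q U (B k)) (biconn⇒linked (B-biconn k) x∈Bk z∈Bk)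

      -- A block l through a ∈ U and b ∈ B k ∖ U would close a cycle b ⋯ a ⋯ z ⋯ b of blocks.
      -- Shortcutting it inside B k first shows that b and z are adjacent ...
      b~z : l ≢ k → a ∈ B l → a ∈ U → b ∈ B l → b ∈ B k → b ∉ U → Adj b z
      b~z {l} {a} {b} l≢k a∈Bl a∈U b∈Bl b∈Bk b∉U = adjacent (crossing (_∈? U) R b∉U z∈U)
        where
        R : Walk (λ x → x ∈ B l ∪ U × x ∈ B k) b z
        R = shortcut-in-block (isBlock k) b∈Bk z∈Bk
              (map (p⊆p∪q U) (biconn⇒linked (B-biconn l) b∈Bl a∈Bl) ++ map (q⊆p∪q (B l) U) (linked a∈U z∈U))
        adjacent : ∃[ c ] ∃[ d ] (c ∈ B l ∪ U × c ∈ B k) × (d ∈ B l ∪ U × d ∈ B k) × c ∉ U × d ∈ U × Adj c d →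
                   Adj b z
        adjacent (c , d , (c∈ , c∈Bk) , (_ , d∈Bk) , c∉U , d∈U , c~d) with x∈p∪q⁻ (B l) U c∈
        ... | inj₂ c∈U = ⊥-elim (c∉U c∈U)
        ... | inj₁ c∈Bl = subst₂ Adj (meet≤1 (l≢k ∘ sym) c∈Bk b∈Bk c∈Bl b∈Bl)
                                     (separated k∉K d∈Bk d∈U z∈Bk z∈U) c~d

      -- ... and then the path b z ⋯ a, simple because b ∉ U, drags z into B l.
      z∈Bl : b ∈ B l → b ∉ U → Adj b z → a ∈ B l → a ∈ U → z ∈ B l
      z∈Bl {b = b} {l = l} {a = a} b∈Bl b∉U b~z a∈Bl a∈U with simplify (linked z∈U a∈U)
      ... | Q , Q-simple = path⊆block (isBlock l) b∈Bl a∈Bl P P-simple (there (start∈ Q′))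
        where
        Q′ = map (q⊆p∪q (B l) U) Q
        P : Walk (_∈ B l ∪ U) b a
        P = cons (p⊆p∪q U b∈Bl) b~z Q′
        b∉Q′ : b ∉ₗ vertices Q′
        b∉Q′ b∈ = b∉U (vertex-satisfies Q (subst (b ∈ₗ_) (vertices-map _ Q) b∈))
        P-simple : Unique (vertices P)
        P-simple = ¬Any⇒All¬ _ b∉Q′ ∷ subst Unique (sym (vertices-map _ Q)) Q-simple

      new-block-meets-once : l ∉ K → l ≢ k → a ∈ B l → a ∈ U → b ∈ B l → b ∈ B k → a ≡ b
      new-block-meets-once {l} {a} {b} l∉K l≢k a∈Bl a∈U b∈Bl b∈Bk with b ∈? U | a ∈? B k
      ... | yes b∈U | _        = separated l∉K a∈Bl a∈U b∈Bl b∈U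
      ... | no _    | yes a∈Bk = meet≤1 l≢k a∈Bl b∈Bl a∈Bk b∈Bk
      ... | no b∉U  | no a∉Bk  = ⊥-elim (a∉Bk (subst (_∈ B k) (sym a≡z) z∈Bk))
        where
        a≡z = separated l∉K a∈Bl a∈U (z∈Bl b∈Bl b∉U (b~z l≢k a∈Bl a∈U b∈Bl b∈Bk b∉U) a∈Bl a∈U) z∈U

      separated′ : l ∉ K ∪ ⁅ k ⁆ → a ∈ B l → a ∈ U ∪ B k → b ∈ B l → b ∈ U ∪ B k → a ≡ b
      separated′ {l} l∉K′ = cases (l∉K′ ∘ p⊆p∪q ⁅ k ⁆) (λ { refl → l∉K′ (q⊆p∪q K ⁅ k ⁆ (x∈⁅x⁆ k)) })
        where
        cases : l ∉ K → l ≢ k → a ∈ B l → a ∈ U ∪ B k → b ∈ B l → b ∈ U ∪ B k → a ≡ b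
        cases l∉K l≢k a∈Bl a∈ b∈Bl b∈ with x∈p∪q⁻ U (B k) a∈ | x∈p∪q⁻ U (B k) b∈
        ... | inj₁ a∈U  | inj₁ b∈U  = separated l∉K a∈Bl a∈U b∈Bl b∈U
        ... | inj₂ a∈Bk | inj₂ b∈Bk = meet≤1 l≢k a∈Bl b∈Bl a∈Bk b∈Bk
        ... | inj₁ a∈U  | inj₂ b∈Bk = new-block-meets-once l∉K l≢k a∈Bl a∈U b∈Bl b∈Bk
        ... | inj₂ a∈Bk | inj₁ b∈U  = sym (new-block-meets-once l∉K l≢k b∈Bl b∈U a∈Bl a∈Bk)

      extended : Cluster (K ∪ ⁅ k ⁆) (U ∪ B k)
      extended = record
        { covers     = covers′
        ; count      = count′
        ; inhabitant = z , p⊆p∪q (B k) z∈U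
        ; linked     = linked′
        ; separated  = separated′
        }
        where
        covers′ : l ∈ K ∪ ⁅ k ⁆ → a ∈ B l → a ∈ U ∪ B k
        covers′ l∈ a∈ with x∈p∪q⁻ K ⁅ k ⁆ l∈
        ... | inj₁ l∈K = p⊆p∪q (B k) (covers l∈K a∈)
        ... | inj₂ l∈k = q⊆p∪q U (B k) (subst (λ l → _ ∈ B l) (x∈⁅y⁆⇒x≡y k l∈k) a∈)

    open Extension using (extended)

    adjacent-block : Cluster K U → l ∉ K → ¬ ¬ (∃[ k ] ∃[ z ] k ∉ K × z ∈ B k × z ∈ U)
    adjacent-block {K} {U} {l} cluster l∉K with proj₁ (B-biconn l) | Cluster.inhabitant cluster
    ... | s , s∈Bl | u , u∈U with s ∈? U
    ...   | yes s∈U = pure (l , s , l∉K , s∈Bl , s∈U)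
    ...   | no  s∉U with crossing (_∈? U) (fromWalkIn (proj₂ G-connected s u)) s∉U u∈U
    ...     | c , d , _ , _ , c∉U , d∈U , c~d = do
      k , c∈Bk , d∈Bk ← edge-in-block c~d
      pure (k , d , (λ k∈K → c∉U (Cluster.covers cluster k∈K c∈Bk)) , d∈Bk , d∈U)

    cluster-all : Acc _⊃_ K → Cluster K U → ¬ ¬ (∃[ U′ ] Cluster ⊤ U′)
    cluster-all {K} {U} (acc larger) cluster with any? (λ k → ¬? (k ∈? K))
    ... | yes (l , l∉K) = do
      k , z , k∉K , z∈Bk , z∈U ← adjacent-block cluster l∉K
      cluster-all (larger (p⊂p∪⁅i⁆ k∉K)) (extended cluster k∉K z∈Bk z∈U)
    ... | no none-missing = pure (U , subst (λ K → Cluster K U) K≡⊤ cluster)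
      where
      K≡⊤ : K ≡ ⊤
      K≡⊤ = ⊆-antisym ⊆⊤ λ {k} _ → decidable-stable (k ∈? K) λ k∉K → none-missing (k , k∉K)

    block-count : ∑⟨ ⊤ ⟩ size + 1 ≡ N + r
    block-count = decidable-stable (_ ℕ.≟ _) do
      k₀ , _ ← vertex-in-block (proj₁ G-connected)
      U , cluster ← cluster-all (⊃-wellFounded _) (cluster-block k₀)
      pure (total cluster)
      where
      total : Cluster ⊤ U → ∑⟨ ⊤ ⟩ size + 1 ≡ N + r
      total {U} cluster = trans count (cong₂ _+_ (trans (cong ∣_∣ U≡⊤) (∣⊤∣≡n N)) (∣⊤∣≡n r))
        where
        open Cluster cluster
        U≡⊤ : U ≡ ⊤
        U≡⊤ = ⊆-antisym ⊆⊤ λ {v} _ → decidable-stable (v ∈? U) do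
          k , v∈Bk ← vertex-in-block v
          pure (covers ∈⊤ v∈Bk)

module DifferenceSolver {c ℓ} (R : CommutativeRing c ℓ) where
  open CommutativeRing R hiding (zero)
  open import Algebra.Properties.Ring ring using (-0#≈0#; -‿+-comm; -‿distribˡ-*; x[y-z]≈xy-xz; ⁻¹-anti-homo‿-)
  open import Algebra.Properties.CommutativeSemigroup +-commutativeSemigroup using (interchange)
  open import Algebra.Properties.Semiring.Mult.TCOptimised semiring using (1+×; ×-homo-+; ×1-homo-*)
    renaming (_×_ to _×′_)
  open import Relation.Binary.Reasoning.Setoid setoid

  [a+b]-[c+d] : ∀ a b c d → (a + b) - (c + d) ≈ (a - c) + (b - d)
  [a+b]-[c+d] a b c d = trans (+-congˡ (sym (-‿+-comm c d))) (interchange a b (- c) (- d))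

  [a-b]-[c-d] : ∀ a b c d → (a - b) - (c - d) ≈ (a + d) - (b + c)
  [a-b]-[c-d] a b c d = begin
    (a - b) - (c - d)  ≈⟨ +-congˡ (⁻¹-anti-homo‿- c d) ⟩
    (a - b) + (d - c)  ≈⟨ [a+b]-[c+d] a d b c ⟨
    (a + d) - (b + c)  ∎

  [x+a]-[x+b] : ∀ x a b → (x + a) - (x + b) ≈ a - b
  [x+a]-[x+b] x a b = begin
    (x + a) - (x + b)  ≈⟨ [a+b]-[c+d] x a x b ⟩
    (x - x) + (a - b)  ≈⟨ +-congʳ (-‿inverseʳ x) ⟩
    0# + (a - b)       ≈⟨ +-identityˡ _ ⟩
    a - b              ∎

  [a-b][c-d] : ∀ a b c d → (a - b) * (c - d) ≈ (a * c + b * d) - (a * d + b * c)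
  [a-b][c-d] a b c d = begin
    (a - b) * (c - d)                  ≈⟨ distribʳ (c - d) a (- b) ⟩
    a * (c - d) + - b * (c - d)        ≈⟨ +-congˡ (-‿distribˡ-* b (c - d)) ⟨
    a * (c - d) - b * (c - d)          ≈⟨ +-cong (x[y-z]≈xy-xz a c d) (-‿cong (x[y-z]≈xy-xz b c d)) ⟩
    (a * c - a * d) - (b * c - b * d)  ≈⟨ [a-b]-[c-d] (a * c) (a * d) (b * c) (b * d) ⟩
    (a * c + b * d) - (a * d + b * c)  ∎

  -- A pair (a , b) stands for the integer a − b.  The solver compares normal forms
  -- syntactically, so the ring operations on pairs keep them normalised (one component 0).
  normalise : ℕ × ℕ → ℕ × ℕ
  normalise (a , b) = a ∸ b , b ∸ a

  _⊕_ _⊗_ : ℕ × ℕ → ℕ × ℕ → ℕ × ℕ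
  (a , b) ⊕ (c , d) = normalise (a ℕ.+ c , b ℕ.+ d)
  (a , b) ⊗ (c , d) = normalise (a ℕ.* c ℕ.+ b ℕ.* d , a ℕ.* d ℕ.+ b ℕ.* c)

  ⊖_ : ℕ × ℕ → ℕ × ℕ
  ⊖ (a , b) = b , a

  differences : RawRing 0ℓ 0ℓ
  differences = record
    { Carrier = ℕ × ℕ ; _≈_ = _≡_ ; _+_ = _⊕_ ; _*_ = _⊗_ ; -_ = ⊖_ ; 0# = 0 , 0 ; 1# = 1 , 0 }

  ι : ℕ → Carrier
  ι a = a ×′ 1#

  -- The case split makes ⟦ 1 , 0 ⟧ reduce to 1#, so that solved identities mention 1# itself.
  ⟦_⟧ : ℕ × ℕ → Carrier
  ⟦ a , zero ⟧  = ι a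
  ⟦ a , suc b ⟧ = ι a - ι (suc b)

  ⟦a,b⟧≈ιa-ιb : ∀ a b → ⟦ a , b ⟧ ≈ ι a - ι b
  ⟦a,b⟧≈ιa-ιb a zero    = sym (trans (+-congˡ -0#≈0#) (+-identityʳ _))
  ⟦a,b⟧≈ιa-ιb a (suc b) = refl

  ⟦normalise⟧ : ∀ a b → ⟦ normalise (a , b) ⟧ ≈ ι a - ι b
  ⟦normalise⟧ zero    zero    = ⟦a,b⟧≈ιa-ιb zero zero
  ⟦normalise⟧ zero    (suc b) = refl
  ⟦normalise⟧ (suc a) zero    = ⟦a,b⟧≈ιa-ιb (suc a) zero
  ⟦normalise⟧ (suc a) (suc b) = begin
    ⟦ normalise (a , b) ⟧        ≈⟨ ⟦normalise⟧ a b ⟩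
    ι a - ι b                    ≈⟨ [x+a]-[x+b] 1# (ι a) (ι b) ⟨
    (1# + ι a) - (1# + ι b)      ≈⟨ +-cong (1+× a 1#) (-‿cong (1+× b 1#)) ⟨
    ι (suc a) - ι (suc b)        ∎

  ι-+ : ∀ a b → ι (a ℕ.+ b) ≈ ι a + ι b
  ι-+ a b = ×-homo-+ 1# a b

  ⟦⟧-homo-+ : ∀ x y → ⟦ x ⊕ y ⟧ ≈ ⟦ x ⟧ + ⟦ y ⟧
  ⟦⟧-homo-+ (a , b) (c , d) = begin
    ⟦ (a , b) ⊕ (c , d) ⟧            ≈⟨ ⟦normalise⟧ (a ℕ.+ c) (b ℕ.+ d) ⟩
    ι (a ℕ.+ c) - ι (b ℕ.+ d)        ≈⟨ +-cong (ι-+ a c) (-‿cong (ι-+ b d)) ⟩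
    (ι a + ι c) - (ι b + ι d)        ≈⟨ [a+b]-[c+d] _ _ _ _ ⟩
    (ι a - ι b) + (ι c - ι d)        ≈⟨ +-cong (⟦a,b⟧≈ιa-ιb a b) (⟦a,b⟧≈ιa-ιb c d) ⟨
    ⟦ a , b ⟧ + ⟦ c , d ⟧            ∎

  ⟦⟧-homo-* : ∀ x y → ⟦ x ⊗ y ⟧ ≈ ⟦ x ⟧ * ⟦ y ⟧
  ⟦⟧-homo-* (a , b) (c , d) = begin
    ⟦ (a , b) ⊗ (c , d) ⟧                                ≈⟨ ⟦normalise⟧ (a ℕ.* c ℕ.+ b ℕ.* d) (a ℕ.* d ℕ.+ b ℕ.* c) ⟩
    ι (a ℕ.* c ℕ.+ b ℕ.* d) - ι (a ℕ.* d ℕ.+ b ℕ.* c)    ≈⟨ +-cong (ι-*+* a c b d) (-‿cong (ι-*+* a d b c)) ⟩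
    (ι a * ι c + ι b * ι d) - (ι a * ι d + ι b * ι c)    ≈⟨ [a-b][c-d] (ι a) (ι b) (ι c) (ι d) ⟨
    (ι a - ι b) * (ι c - ι d)                            ≈⟨ *-cong (⟦a,b⟧≈ιa-ιb a b) (⟦a,b⟧≈ιa-ιb c d) ⟨
    ⟦ a , b ⟧ * ⟦ c , d ⟧                                ∎
    where
    ι-*+* : ∀ w x y z → ι (w ℕ.* x ℕ.+ y ℕ.* z) ≈ ι w * ι x + ι y * ι z
    ι-*+* w x y z = trans (ι-+ (w ℕ.* x) (y ℕ.* z)) (+-cong (×1-homo-* w x) (×1-homo-* y z))

  ⟦⟧-homo-- : ∀ x → ⟦ ⊖ x ⟧ ≈ - ⟦ x ⟧
  ⟦⟧-homo-- (a , b) = begin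
    ⟦ b , a ⟧        ≈⟨ ⟦a,b⟧≈ιa-ιb b a ⟩
    ι b - ι a        ≈⟨ ⁻¹-anti-homo‿- (ι a) (ι b) ⟨
    - (ι a - ι b)    ≈⟨ -‿cong (⟦a,b⟧≈ιa-ιb a b) ⟨
    - ⟦ a , b ⟧      ∎

  ⟦⟧-morphism : differences -Raw-AlmostCommutative⟶ fromCommutativeRing R
  ⟦⟧-morphism = record
    { ⟦_⟧ = ⟦_⟧ ; +-homo = ⟦⟧-homo-+ ; *-homo = ⟦⟧-homo-* ; -‿homo = ⟦⟧-homo--
    ; 0-homo = refl ; 1-homo = refl }

  coefficient-≟ : ∀ x y → Maybe (⟦ x ⟧ ≈ ⟦ y ⟧)
  coefficient-≟ x y with ≡-dec _≟ℕ_ _≟ℕ_ x y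
  ... | yes x≡y = just (reflexive (≡.cong ⟦_⟧ x≡y))
  ... | no  _   = nothing

  open Algebra.Solver.Ring differences (fromCommutativeRing R) ⟦⟧-morphism coefficient-≟ public
    using (solve; _:=_; _:+_; _:*_; _:-_; con)

module FieldSums {c ℓ} (F : Field c ℓ) where
  open Field F hiding (zero)
  open import Algebra.Properties.Ring ring using (-1*x≈-x)
  open import Algebra.Properties.Semiring.Sum semiring using (sum; sum-cong-≋; *-distribˡ-sum; sum-replicate)
    renaming (∑-distrib-+ to sum-distrib-+; ∑-comm to sum-comm)
  open import Algebra.Properties.Semiring.Mult semiring using (×-homo-+) renaming (_×_ to _×ᵤ_)
  open import Relation.Binary.Reasoning.Setoid setoid

  ∑≡sum : ∀ n f → ∑ n f ≡ sum f
  ∑≡sum zero    f = ≡.refl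
  ∑≡sum (suc n) f = ≡.cong (f zero +_) (∑≡sum n (f ∘ suc))

  ∑-cong : ∀ n {f g} → (∀ i → f i ≈ g i) → ∑ n f ≈ ∑ n g
  ∑-cong n {f} {g} f≈g = begin
    ∑ n f  ≡⟨ ∑≡sum n f ⟩
    sum f  ≈⟨ sum-cong-≋ f≈g ⟩
    sum g  ≡⟨ ∑≡sum n g ⟨
    ∑ n g  ∎

  ∑-+ : ∀ n f g → ∑ n (λ i → f i + g i) ≈ ∑ n f + ∑ n g
  ∑-+ n f g = begin
    ∑ n (λ i → f i + g i)  ≡⟨ ∑≡sum n _ ⟩
    sum (λ i → f i + g i)  ≈⟨ sum-distrib-+ f g ⟩
    sum f + sum g          ≡⟨ ≡.cong₂ _+_ (∑≡sum n f) (∑≡sum n g) ⟨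
    ∑ n f + ∑ n g          ∎

  ∑-*ˡ : ∀ n a f → ∑ n (λ i → a * f i) ≈ a * ∑ n f
  ∑-*ˡ n a f = begin
    ∑ n (λ i → a * f i)  ≡⟨ ∑≡sum n _ ⟩
    sum (λ i → a * f i)  ≈⟨ *-distribˡ-sum a f ⟨
    a * sum f            ≡⟨ ≡.cong (a *_) (∑≡sum n f) ⟨
    a * ∑ n f            ∎

  ∑-comm : ∀ n m (h : Fin n → Fin m → Carrier) → ∑ n (λ i → ∑ m (h i)) ≈ ∑ m (λ j → ∑ n (λ i → h i j))
  ∑-comm n m h = begin
    ∑ n (λ i → ∑ m (h i))                ≈⟨ ∑-cong n (λ i → reflexive (∑≡sum m (h i))) ⟩
    ∑ n (λ i → sum (h i))                ≡⟨ ∑≡sum n _ ⟩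
    sum (λ i → sum (h i))                ≈⟨ sum-comm h ⟩
    sum (λ j → sum (λ i → h i j))        ≡⟨ ∑≡sum m _ ⟨
    ∑ m (λ j → sum (λ i → h i j))        ≈⟨ ∑-cong m (λ j → reflexive (∑≡sum n (λ i → h i j))) ⟨
    ∑ m (λ j → ∑ n (λ i → h i j))        ∎

  ∑-neg : ∀ n f → ∑ n (λ i → - f i) ≈ - ∑ n f
  ∑-neg n f = begin
    ∑ n (λ i → - f i)       ≈⟨ ∑-cong n (λ i → -1*x≈-x (f i)) ⟨
    ∑ n (λ i → - 1# * f i)  ≈⟨ ∑-*ˡ n (- 1#) f ⟩
    - 1# * ∑ n f            ≈⟨ -1*x≈-x _ ⟩
    - ∑ n f                 ∎

  ∑-− : ∀ n f g → ∑ n (λ i → f i - g i) ≈ ∑ n f - ∑ n g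
  ∑-− n f g = trans (∑-+ n f (λ i → - g i)) (+-congˡ (∑-neg n g))

  fromℕ≡×1# : ∀ n → fromℕ n ≡ n ×ᵤ 1#
  fromℕ≡×1# zero    = ≡.refl
  fromℕ≡×1# (suc n) = ≡.cong (1# +_) (fromℕ≡×1# n)

  fromℕ-+ : ∀ a b → fromℕ (a ℕ.+ b) ≈ fromℕ a + fromℕ b
  fromℕ-+ a b = begin
    fromℕ (a ℕ.+ b)         ≡⟨ fromℕ≡×1# (a ℕ.+ b) ⟩
    (a ℕ.+ b) ×ᵤ 1#         ≈⟨ ×-homo-+ 1# a b ⟩
    a ×ᵤ 1# + b ×ᵤ 1#       ≡⟨ ≡.cong₂ _+_ (fromℕ≡×1# a) (fromℕ≡×1# b) ⟨
    fromℕ a + fromℕ b       ∎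

  ∑-1# : ∀ n → ∑ n (λ _ → 1#) ≈ fromℕ n
  ∑-1# n = begin
    ∑ n (λ _ → 1#)        ≡⟨ ∑≡sum n _ ⟩
    sum {n} (λ _ → 1#)    ≈⟨ sum-replicate n ⟩
    n ×ᵤ 1#               ≡⟨ fromℕ≡×1# n ⟨
    fromℕ n               ∎

  ∑-1#-* : ∀ n a f → ∑ n (λ i → 1# - a * f i) ≈ fromℕ n - a * ∑ n f
  ∑-1#-* n a f = trans (∑-− n _ _) (+-cong (∑-1# n) (-‿cong (∑-*ˡ n a f)))

  fromℕ-∑⟨⊤⟩ : ∀ n (w : Fin n → ℕ) → fromℕ (∑⟨ ⊤ ⟩ w) ≈ ∑ n (fromℕ ∘ w)
  fromℕ-∑⟨⊤⟩ zero    w = refl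
  fromℕ-∑⟨⊤⟩ (suc n) w = trans (fromℕ-+ (w zero) _) (+-congˡ (fromℕ-∑⟨⊤⟩ n (w ∘ suc)))

  fromℕ-excess : ∀ n (w : Fin n → ℕ) M → ∑⟨ ⊤ ⟩ w ℕ.+ 1 ≡ M ℕ.+ n → ∑ n (fromℕ ∘ w) - fromℕ M ≈ fromℕ n - 1#
  fromℕ-excess n w M count = begin
    S - fromℕ M                          ≈⟨ shift S (fromℕ M) ⟩
    ((S + 1#) - fromℕ M) - 1#            ≈⟨ +-congʳ (+-congʳ S+1≈M+n) ⟩
    ((fromℕ M + fromℕ n) - fromℕ M) - 1# ≈⟨ cancel (fromℕ M) (fromℕ n) ⟩
    fromℕ n - 1#                         ∎
    where
    open DifferenceSolver commutativeRing
    S = ∑ n (fromℕ ∘ w)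
    S+1≈M+n : S + 1# ≈ fromℕ M + fromℕ n
    S+1≈M+n = begin
      S + 1#                      ≈⟨ +-cong (fromℕ-∑⟨⊤⟩ n w) (+-identityʳ 1#) ⟨
      fromℕ (∑⟨ ⊤ ⟩ w) + fromℕ 1  ≈⟨ fromℕ-+ (∑⟨ ⊤ ⟩ w) 1 ⟨
      fromℕ (∑⟨ ⊤ ⟩ w ℕ.+ 1)      ≡⟨ ≡.cong fromℕ count ⟩
      fromℕ (M ℕ.+ n)             ≈⟨ fromℕ-+ M n ⟩
      fromℕ M + fromℕ n           ∎
    shift : ∀ a b → a - b ≈ ((a + 1#) - b) - 1#
    shift = solve 2 (λ a b → a :- b := ((a :+ con (1 , 0)) :- b) :- con (1 , 0)) refl
    cancel : ∀ a b → ((a + b) - a) - 1# ≈ b - 1#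
    cancel = solve 2 (λ a b → ((a :+ b) :- a) :- con (1 , 0) := b :- con (1 , 0)) refl

  ∑-select : ∀ {n} (S : Subset n) {a} (f : Fin n → Carrier) →
             (∀ {v} → v ∈ S → f v ≈ a) → (∀ {v} → v ∉ S → f v ≈ 0#) → ∑ n f ≈ fromℕ ∣ S ∣ * a
  ∑-select []            f on off = sym (zeroˡ _)
  ∑-select (inside ∷ S)  {a} f on off = begin
    f zero + ∑ _ (f ∘ suc)     ≈⟨ +-cong (on here) (∑-select S (f ∘ suc) (on ∘ there) (off ∘ (_∘ drop-there))) ⟩
    a + fromℕ ∣ S ∣ * a        ≈⟨ +-congʳ (*-identityˡ a) ⟨
    1# * a + fromℕ ∣ S ∣ * a   ≈⟨ distribʳ a 1# _ ⟨
    (1# + fromℕ ∣ S ∣) * a     ∎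
  ∑-select (outside ∷ S) f on off =
    trans (+-cong (off λ ()) (∑-select S (f ∘ suc) (on ∘ there) (off ∘ (_∘ drop-there)))) (+-identityˡ _)

module BlockContribution {c ℓ} (F : Field c ℓ) where
  open Field F
  open DifferenceSolver commutativeRing
  open import Algebra.Properties.Ring ring using (x∙y⁻¹≈ε⇒x≈y)
  open import Relation.Binary.Reasoning.Setoid setoid

  nonzero-* : ∀ {a b} → ¬ (a ≈ 0#) → ¬ (b ≈ 0#) → ¬ (a * b ≈ 0#)
  nonzero-* {a} {b} a≉0 b≉0 ab≈0 = b≉0 (begin
    b                ≈⟨ *-identityˡ b ⟨
    1# * b           ≈⟨ *-congʳ (trans (*-comm _ _) (⁻¹-inverse a a≉0)) ⟨
    (a ⁻¹ * a) * b   ≈⟨ *-assoc _ _ _ ⟩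
    a ⁻¹ * (a * b)   ≈⟨ *-congˡ ab≈0 ⟩
    a ⁻¹ * 0#        ≈⟨ zeroʳ _ ⟩
    0#               ∎)

  denominator : Carrier → Carrier → Carrier → Carrier
  denominator q μ ν = (q + 1#) * (q * q * (μ - 1#) * (ν - 1#) - 1#)

  numerator : Carrier → Carrier → Carrier → Carrier
  numerator q μ ν = (q + 1#) * (q + 1#) * (μ - 1#) * (ν - 1#) - μ * ν

  contribution : ∀ q μ ν → ¬ (q + 1# ≈ 0#) → ¬ (q * q * (μ - 1#) * (ν - 1#) ≈ 1#) →
                 μ * ((q * (ν - 1#) - 1#) ÷ denominator q μ ν) + ν * ((q * (μ - 1#) - 1#) ÷ denominator q μ ν)
                   ≈ 1# - (q - 1#) * (numerator q μ ν ÷ denominator q μ ν)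
  contribution q μ ν q+1≉0 q²μ′ν′≉1 = begin
    μ * (α * D ⁻¹) + ν * (β * D ⁻¹)      ≈⟨ identity q μ ν (D ⁻¹) ⟩
    D * D ⁻¹ - (q - 1#) * (L * D ⁻¹)     ≈⟨ +-congʳ (⁻¹-inverse D D≉0) ⟩
    1# - (q - 1#) * (L * D ⁻¹)           ∎
    where
    α = q * (ν - 1#) - 1#
    β = q * (μ - 1#) - 1#
    D = denominator q μ ν
    L = numerator q μ ν
    D≉0 : ¬ (D ≈ 0#)
    D≉0 = nonzero-* q+1≉0 (q²μ′ν′≉1 ∘ x∙y⁻¹≈ε⇒x≈y _ _)
    identity : ∀ q μ ν I →
      μ * ((q * (ν - 1#) - 1#) * I) + ν * ((q * (μ - 1#) - 1#) * I)
        ≈ denominator q μ ν * I - (q - 1#) * (numerator q μ ν * I)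
    identity = solve 4 (λ q μ ν I →
      μ :* ((q :* (ν :- 𝟏) :- 𝟏) :* I) :+ ν :* ((q :* (μ :- 𝟏) :- 𝟏) :* I)
        := (q :+ 𝟏) :* (q :* q :* (μ :- 𝟏) :* (ν :- 𝟏) :- 𝟏) :* I
           :- (q :- 𝟏) :* (((q :+ 𝟏) :* (q :+ 𝟏) :* (μ :- 𝟏) :* (ν :- 𝟏) :- μ :* ν) :* I)) refl
      where 𝟏 = con (1 , 0)

module VertexSum {c ℓ} (F : Field c ℓ) {N r : ℕ} (X Y : Fin r → Subset N) where
  open Field F hiding (zero)
  open Quantities F X Y
  open FieldSums F
  open import Relation.Binary.Reasoning.Setoid setoid

  ifIn-∈ : ∀ {v S a} → v ∈ S → ifIn v S a ≈ a
  ifIn-∈ {v} {S} v∈S with v ∈? S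
  ... | yes _   = refl
  ... | no v∉S = ⊥-elim (v∉S v∈S)

  ifIn-∉ : ∀ {v S a} → v ∉ S → ifIn v S a ≈ 0#
  ifIn-∉ {v} {S} v∉S with v ∈? S
  ... | yes v∈S = ⊥-elim (v∉S v∈S)
  ... | no _    = refl

  ∑-ifIn : ∀ (S : Fin r → Subset N) (w : Fin r → Carrier) →
           ∑ N (λ v → ∑ r (λ k → ifIn v (S k) (w k))) ≈ ∑ r (λ k → fromℕ ∣ S k ∣ * w k)
  ∑-ifIn S w = trans (∑-comm N r _) (∑-cong r λ k → ∑-select (S k) _ ifIn-∈ ifIn-∉)

  wX wY : Carrier → Fin r → Carrier
  wX q k = (q * (n k - 1#) - 1#) ÷ ((q + 1#) * Δ q k)
  wY q k = (q * (m k - 1#) - 1#) ÷ ((q + 1#) * Δ q k)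

  ∑-x : ∀ q → ∑ N (x q) ≈ ∑ r (λ k → m k * wX q k + n k * wY q k) - (∑ r (λ k → fromℕ ∣ X k ∪ Y k ∣) - fromℕ N)
  ∑-x q = begin
    ∑ N (λ v → (A v + B v) - (dhat v - 1#))               ≈⟨ ∑-− N _ _ ⟩
    ∑ N (λ v → A v + B v) - ∑ N (λ v → dhat v - 1#)       ≈⟨ +-cong (∑-+ N A B) (-‿cong (∑-− N dhat _)) ⟩
    (∑ N A + ∑ N B) - (∑ N dhat - ∑ N (λ _ → 1#))         ≈⟨ +-cong (+-cong (∑-ifIn X (wX q)) (∑-ifIn Y (wY q)))
                                                                  (-‿cong (+-cong ∑-dhat (-‿cong (∑-1# N)))) ⟩
    (∑ r (λ k → m k * wX q k) + ∑ r (λ k → n k * wY q k)) - (∑ r (λ k → fromℕ ∣ X k ∪ Y k ∣) - fromℕ N)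
                                                          ≈⟨ +-congʳ (∑-+ r _ _) ⟨
    ∑ r (λ k → m k * wX q k + n k * wY q k) - (∑ r (λ k → fromℕ ∣ X k ∪ Y k ∣) - fromℕ N) ∎
    where
    A B : Fin N → Carrier
    A v = ∑ r (λ k → ifIn v (X k) (wX q k))
    B v = ∑ r (λ k → ifIn v (Y k) (wY q k))
    ∑-dhat : ∑ N dhat ≈ ∑ r (λ k → fromℕ ∣ X k ∪ Y k ∣)
    ∑-dhat = trans (∑-ifIn (λ k → X k ∪ Y k) (λ _ → 1#)) (∑-cong r λ _ → *-identityʳ _)

lemma4p5 : ∀ {c ℓ} (F : Field c ℓ) → Field.CharacteristicZero F →
  ∀ {N r : ℕ} (G : Graph N) (X Y : Fin r → Subset N) → BiBlock G r X Y →
  (q : Field.Carrier F) →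
  let open Field F
      open Quantities F X Y
  in ¬ (q + 1# ≈ 0#) →
     (∀ k → ¬ (q * q * (m k - 1#) * (n k - 1#) ≈ 1#)) →
     ∑ N (x q) ≈ 1# - (q - 1#) * λG q
lemma4p5 F _ {N} {r} G X Y bi-block q q+1≉0 q²m′n′≉1 = begin
  ∑ N (x q)
    ≈⟨ ∑-x q ⟩
  ∑ r (λ k → m k * wX q k + n k * wY q k) - (∑ r (fromℕ ∘ size) - fromℕ N)
    ≈⟨ +-cong (∑-cong r λ k → contribution q (m k) (n k) q+1≉0 (q²m′n′≉1 k))
              (-‿cong (fromℕ-excess r size N block-count)) ⟩
  ∑ r (λ k → 1# - (q - 1#) * λ-summand k) - (fromℕ r - 1#)
    ≈⟨ +-congʳ (∑-1#-* r (q - 1#) λ-summand) ⟩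
  (fromℕ r - (q - 1#) * λG q) - (fromℕ r - 1#)
    ≈⟨ rearrange (fromℕ r) ((q - 1#) * λG q) ⟩
  1# - (q - 1#) * λG q ∎
  where
  open Field F hiding (zero)
  open Quantities F X Y
  open FieldSums F
  open BlockContribution F
  open VertexSum F X Y
  open DifferenceSolver commutativeRing
  open import Relation.Binary.Reasoning.Setoid setoid
  open BiBlock bi-block

  size : Fin r → ℕ
  size k = ∣ X k ∪ Y k ∣

  block-count : ∑⟨ ⊤ ⟩ size ℕ.+ 1 ≡ N ℕ.+ r
  block-count = Graphs.BlockCount.block-count G connected (λ k → X k ∪ Y k) isBlock distinct allBlocks

  λ-summand : Fin r → Carrier
  λ-summand k = numerator q (m k) (n k) ÷ denominator q (m k) (n k)

  rearrange : ∀ ρ a → (ρ - a) - (ρ - 1#) ≈ 1# - a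
  rearrange = solve 2 (λ ρ a → (ρ :- a) :- (ρ :- con (1 , 0)) := con (1 , 0) :- a) refl
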